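{- For any polynomial $f$ and any non-negative integers $r,s$, $$(x+1)^s f(\mathbf{F}_{\mathbf{x}}+r-s)(\mathbf{F}_{\mathbf{x}})_s=x^s f(\mathbf{F}_{\mathbf{x}}+r)(\mathbf{F}_{\mathbf{x}}+s)_s.$$
   Context: $(\alpha)_j=\alpha(\alpha-1)\cdots(\alpha-j+1)$ for $j\ge1$, $(\alpha)_0=1$. ${n\brace k}$ denotes the Stirling numbers of the second kind, $\mathcal{F}_n(x)=\sum_{k=0}^n {n\brace k}k!\,x^k$ the Fubini polynomials. Umbral notation: for a polynomial $h(u)=\sum_k c_k u^k$, $h(\mathbf{F}_{\mathbf{x}}):=\sum_k c_k\mathcal{F}_k(x)$ (linear map $u^k\mapsto\mathcal{F}_k(x)$); products such as $f(\mathbf{F}_{\mathbf{x}}+r-s)(\mathbf{F}_{\mathbf{x}})_s$ mean: form the polynomial $f(u+r-s)(u)_s$ in $u$, then apply this map. -}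

module Defs where

open import Level using (Level)
open import Data.Nat as ℕ using (ℕ; zero; suc)
open import Data.Nat using (_!)
open import Data.List using (List; []; _∷_)
open import Algebra.Bundles using (CommutativeRing)

stirling2 : ℕ → ℕ → ℕ
stirling2 zero    zero    = 1
stirling2 zero    (suc k) = 0
stirling2 (suc n) zero    = 0
stirling2 (suc n) (suc k) = suc k ℕ.* stirling2 n (suc k) ℕ.+ stirling2 n k

module Poly {c ℓ : Level} (R : CommutativeRing c ℓ) where
  open CommutativeRing R

  ι : ℕ → Carrier
  ι zero    = 0#
  ι (suc n) = 1# + ι n

  pow : Carrier → ℕ → Carrier
  pow x zero    = 1#
  pow x (suc n) = x * pow x n

  sumTo : ℕ → (ℕ → Carrier) → Carrier
  sumTo zero    g = 0#
  sumTo (suc m) g = sumTo m g + g m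

  fubini : ℕ → Carrier → Carrier
  fubini n x = sumTo (suc n) (λ k → ι (stirling2 n k ℕ.* (k !)) * pow x k)

  -- Polynomials in the umbral variable u: coefficient lists, constant term first.
  Pol : Set c
  Pol = List Carrier

  _+ₚ_ : Pol → Pol → Pol
  []       +ₚ q        = q
  (a ∷ p)  +ₚ []       = a ∷ p
  (a ∷ p)  +ₚ (b ∷ q)  = (a + b) ∷ (p +ₚ q)

  scale : Carrier → Pol → Pol
  scale a []      = []
  scale a (b ∷ p) = (a * b) ∷ scale a p

  shiftU : Pol → Pol
  shiftU p = 0# ∷ p

  _*ₚ_ : Pol → Pol → Pol
  []      *ₚ q = []
  (a ∷ p) *ₚ q = scale a q +ₚ shiftU (p *ₚ q)

  uPlus : Carrier → Pol
  uPlus a = a ∷ 1# ∷ []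

  -- translate p(u) ↦ p(u + a)   (Horner: a0 + u·g(u) ↦ a0 + (u+a)·g(u+a))
  translate : Carrier → Pol → Pol
  translate a []      = []
  translate a (b ∷ p) = (b ∷ []) +ₚ (uPlus a *ₚ translate a p)

  falling : Carrier → ℕ → Pol
  falling a zero    = 1# ∷ []
  falling a (suc s) = falling a s *ₚ uPlus (a - ι s)

  -- umbral evaluation h(F_x): u^k ↦ F_k(x), extended linearly
  umbralFrom : ℕ → Carrier → Pol → Carrier
  umbralFrom k x []      = 0#
  umbralFrom k x (a ∷ p) = a * fubini k x + umbralFrom (suc k) x p

  umbral : Carrier → Pol → Carrier
  umbral x p = umbralFrom 0 x p

-- Shifting a polynomial through the Fubini umbra U(h) = h(F_x), u^k ↦ F_k(x).
--
-- Everything rests on the identity  (x + 1) U(h(u)) = x U(h(u + 1)) + h(0)  (★).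
-- Expand h = Σ_k c_k (u)_k in falling factorials: c_k = Σ_i h_i S(i,k), and
-- U(h) = Σ_k k! x^k c_k; since (u+1)_{k+1} = (u)_{k+1} + (k+1)(u)_k, h(u + 1) has
-- coordinates c_k + (k+1) c_{k+1}, and (★) follows termwise.  Iterating (★),
-- (x + 1)^s U(h) = x^s U(h(u + s)) when h(0) = … = h(s-1) = 0.  For
-- h(u) = f(u + r - s)(u)_s this vanishing holds as (j)_s = 0 for j < s, and
-- h(u + s) = f(u + r)(u + s)_s because translation is a ring endomorphism of
-- R[u] with translate b ∘ translate a = translate (a + b).
module Submission where

open import Defs
open import Level using (Level)
open import Data.Nat as N using (ℕ; zero; suc; _<_; _≤_; z≤n; s≤s; _!)
open import Data.Nat.Properties as NP using ()
open import Data.List using (List; []; _∷_; length)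
open import Data.Sum using (inj₁; inj₂)
open import Algebra.Bundles using (CommutativeRing)
open import Relation.Binary.PropositionalEquality as P using (_≡_)
open import Data.Maybe using (nothing)
open import Tactic.RingSolver.Core.AlmostCommutativeRing using (fromCommutativeRing)
import Relation.Binary.Reasoning.Setoid as SetoidReasoning
import Algebra.Properties.CommutativeSemigroup as CommSemigroupProperties
import Algebra.Properties.Semiring.Mult as SemiringMult
import Algebra.Solver.CommutativeMonoid as CommMonoidSolver

module UmbralShift {c ℓ : Level} (R : CommutativeRing c ℓ) where
  open CommutativeRing R renaming (zero to *-zero)
  open Poly R
  open import Tactic.RingSolver.NonReflective (fromCommutativeRing R (λ _ → nothing))
  open SetoidReasoning setoid
  open CommSemigroupProperties +-commutativeSemigroup using () renaming (interchange to +-interchange)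
  open CommSemigroupProperties *-commutativeSemigroup using () renaming (xy∙z≈y∙xz to *-exchange)
  open SemiringMult semiring using (_×_; ×-homo-+; ×1-homo-*)
  open CommMonoidSolver *-commutativeMonoid using () renaming (solve to solve*; _⊕_ to _·_; _⊜_ to _⊜*_)

  -- ι n is the library's n × 1#, so its homomorphism laws are imported.
  ι≡×1 : ∀ n → ι n ≡ n × 1#
  ι≡×1 zero    = P.refl
  ι≡×1 (suc n) = P.cong (1# +_) (ι≡×1 n)

  ι-+ : ∀ m n → ι (m N.+ n) ≈ ι m + ι n
  ι-+ m n rewrite ι≡×1 (m N.+ n) | ι≡×1 m | ι≡×1 n = ×-homo-+ 1# m n

  ι-* : ∀ m n → ι (m N.* n) ≈ ι m * ι n
  ι-* m n rewrite ι≡×1 (m N.* n) | ι≡×1 m | ι≡×1 n = ×1-homo-* m n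

  coeff : ℕ → Pol → Carrier
  coeff n       []      = 0#
  coeff zero    (a ∷ p) = a
  coeff (suc n) (a ∷ p) = coeff n p

  -- Two coefficient lists denote the same polynomial when all coefficients
  -- agree; this forgets the trailing zeros that the list operations leave.
  infix 4 _≐_
  record _≐_ (p q : Pol) : Set ℓ where
    constructor mk
    field get : ∀ n → coeff n p ≈ coeff n q
  open _≐_

  ≐-refl : ∀ {p} → p ≐ p
  ≐-refl = mk λ n → refl

  ≐-sym : ∀ {p q} → p ≐ q → q ≐ p
  ≐-sym h = mk λ n → sym (get h n)

  infixr 3 _⨾_
  _⨾_ : ∀ {p q w} → p ≐ q → q ≐ w → p ≐ w
  h ⨾ k = mk λ n → trans (get h n) (get k n)

  cons-cong : ∀ {a b p q} → a ≈ b → p ≐ q → (a ∷ p) ≐ (b ∷ q)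
  cons-cong e h = mk λ { zero → e ; (suc n) → get h n }

  ≐-tail : ∀ {a b p q} → (a ∷ p) ≐ (b ∷ q) → p ≐ q
  ≐-tail h = mk λ n → get h (suc n)

  ≐-tail₀ : ∀ {a p} → (a ∷ p) ≐ [] → p ≐ []
  ≐-tail₀ h = mk λ n → get h (suc n)

  zero-poly : (0# ∷ []) ≐ []
  zero-poly = mk λ { zero → refl ; (suc n) → refl }

  coeff-+ : ∀ p q n → coeff n (p +ₚ q) ≈ coeff n p + coeff n q
  coeff-+ []      q       n       = sym (+-identityˡ _)
  coeff-+ (a ∷ p) []      n       = sym (+-identityʳ _)
  coeff-+ (a ∷ p) (b ∷ q) zero    = refl
  coeff-+ (a ∷ p) (b ∷ q) (suc n) = coeff-+ p q n

  coeff-scale : ∀ a p n → coeff n (scale a p) ≈ a * coeff n p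
  coeff-scale a []      n       = sym (zeroʳ a)
  coeff-scale a (b ∷ p) zero    = refl
  coeff-scale a (b ∷ p) (suc n) = coeff-scale a p n

  +ₚ-cong : ∀ {p p' q q'} → p ≐ p' → q ≐ q' → (p +ₚ q) ≐ (p' +ₚ q')
  +ₚ-cong {p} {p'} {q} {q'} h k = mk λ n → begin
    coeff n (p +ₚ q)             ≈⟨ coeff-+ p q n ⟩
    coeff n p + coeff n q        ≈⟨ +-cong (get h n) (get k n) ⟩
    coeff n p' + coeff n q'      ≈⟨ coeff-+ p' q' n ⟨
    coeff n (p' +ₚ q')           ∎

  scale-cong : ∀ {a b p q} → a ≈ b → p ≐ q → scale a p ≐ scale b q
  scale-cong {a} {b} {p} {q} e h = mk λ n → begin
    coeff n (scale a p)          ≈⟨ coeff-scale a p n ⟩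
    a * coeff n p                ≈⟨ *-cong e (get h n) ⟩
    b * coeff n q                ≈⟨ coeff-scale b q n ⟨
    coeff n (scale b q)          ∎

  +ₚ-identityʳ : ∀ p → (p +ₚ []) ≐ p
  +ₚ-identityʳ p = mk λ n → trans (coeff-+ p [] n) (+-identityʳ _)

  +ₚ-interchange : ∀ p q w v → ((p +ₚ q) +ₚ (w +ₚ v)) ≐ ((p +ₚ w) +ₚ (q +ₚ v))
  +ₚ-interchange p q w v = mk λ n → begin
    coeff n ((p +ₚ q) +ₚ (w +ₚ v))                        ≈⟨ coeff-+ (p +ₚ q) (w +ₚ v) n ⟩
    coeff n (p +ₚ q) + coeff n (w +ₚ v)                   ≈⟨ +-cong (coeff-+ p q n) (coeff-+ w v n) ⟩
    (coeff n p + coeff n q) + (coeff n w + coeff n v)     ≈⟨ +-interchange _ _ _ _ ⟩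
    (coeff n p + coeff n w) + (coeff n q + coeff n v)     ≈⟨ +-cong (coeff-+ p w n) (coeff-+ q v n) ⟨
    coeff n (p +ₚ w) + coeff n (q +ₚ v)                   ≈⟨ coeff-+ (p +ₚ w) (q +ₚ v) n ⟨
    coeff n ((p +ₚ w) +ₚ (q +ₚ v))                        ∎

  shiftU-+ : ∀ p q → (0# ∷ (p +ₚ q)) ≐ ((0# ∷ p) +ₚ (0# ∷ q))
  shiftU-+ p q = cons-cong (sym (+-identityʳ 0#)) ≐-refl

  scale-distribˡ : ∀ a p q → scale a (p +ₚ q) ≐ (scale a p +ₚ scale a q)
  scale-distribˡ a p q = mk λ n → begin
    coeff n (scale a (p +ₚ q))                   ≈⟨ coeff-scale a (p +ₚ q) n ⟩
    a * coeff n (p +ₚ q)                         ≈⟨ *-congˡ (coeff-+ p q n) ⟩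
    a * (coeff n p + coeff n q)                  ≈⟨ distribˡ _ _ _ ⟩
    a * coeff n p + a * coeff n q                ≈⟨ +-cong (coeff-scale a p n) (coeff-scale a q n) ⟨
    coeff n (scale a p) + coeff n (scale a q)    ≈⟨ coeff-+ (scale a p) (scale a q) n ⟨
    coeff n (scale a p +ₚ scale a q)             ∎

  scale-distribʳ : ∀ a b p → scale (a + b) p ≐ (scale a p +ₚ scale b p)
  scale-distribʳ a b p = mk λ n → begin
    coeff n (scale (a + b) p)                    ≈⟨ coeff-scale (a + b) p n ⟩
    (a + b) * coeff n p                          ≈⟨ distribʳ _ _ _ ⟩
    a * coeff n p + b * coeff n p                ≈⟨ +-cong (coeff-scale a p n) (coeff-scale b p n) ⟨
    coeff n (scale a p) + coeff n (scale b p)    ≈⟨ coeff-+ (scale a p) (scale b p) n ⟨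
    coeff n (scale a p +ₚ scale b p)             ∎

  scale-assoc : ∀ a b p → scale a (scale b p) ≐ scale (a * b) p
  scale-assoc a b p = mk λ n → begin
    coeff n (scale a (scale b p))   ≈⟨ coeff-scale a (scale b p) n ⟩
    a * coeff n (scale b p)         ≈⟨ *-congˡ (coeff-scale b p n) ⟩
    a * (b * coeff n p)             ≈⟨ *-assoc _ _ _ ⟨
    (a * b) * coeff n p             ≈⟨ coeff-scale (a * b) p n ⟨
    coeff n (scale (a * b) p)       ∎

  scale-comm : ∀ a b p → scale a (scale b p) ≐ scale b (scale a p)
  scale-comm a b p = scale-assoc a b p ⨾ scale-cong (*-comm a b) ≐-refl ⨾ ≐-sym (scale-assoc b a p)

  scale-zero : ∀ p → scale 0# p ≐ []
  scale-zero p = mk λ n → trans (coeff-scale 0# p n) (zeroˡ _)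

  scale-identity : ∀ p → scale 1# p ≐ p
  scale-identity p = mk λ n → trans (coeff-scale 1# p n) (*-identityˡ _)

  scale-shiftU : ∀ a p → scale a (0# ∷ p) ≐ (0# ∷ scale a p)
  scale-shiftU a p = cons-cong (zeroʳ a) ≐-refl

  *ₚ-zeroˡ : ∀ p q → p ≐ [] → (p *ₚ q) ≐ []
  *ₚ-zeroˡ []      q h = ≐-refl
  *ₚ-zeroˡ (a ∷ p) q h =
    +ₚ-cong (scale-cong (get h zero) ≐-refl ⨾ scale-zero q)
            (cons-cong refl (*ₚ-zeroˡ p q (≐-tail₀ h)) ⨾ zero-poly)

  *ₚ-zeroʳ : ∀ p → (p *ₚ []) ≐ []
  *ₚ-zeroʳ []      = ≐-refl
  *ₚ-zeroʳ (a ∷ p) = cons-cong refl (*ₚ-zeroʳ p) ⨾ zero-poly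

  *ₚ-congˡ : ∀ p p' q → p ≐ p' → (p *ₚ q) ≐ (p' *ₚ q)
  *ₚ-congˡ []      []       q h = ≐-refl
  *ₚ-congˡ []      (b ∷ p') q h = ≐-sym (*ₚ-zeroˡ (b ∷ p') q (≐-sym h))
  *ₚ-congˡ (a ∷ p) []       q h = *ₚ-zeroˡ (a ∷ p) q h
  *ₚ-congˡ (a ∷ p) (b ∷ p') q h =
    +ₚ-cong (scale-cong (get h zero) ≐-refl) (cons-cong refl (*ₚ-congˡ p p' q (≐-tail h)))

  *ₚ-congʳ : ∀ p q q' → q ≐ q' → (p *ₚ q) ≐ (p *ₚ q')
  *ₚ-congʳ []      q q' h = ≐-refl
  *ₚ-congʳ (a ∷ p) q q' h = +ₚ-cong (scale-cong refl h) (cons-cong refl (*ₚ-congʳ p q q' h))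

  *ₚ-cong : ∀ {p p' q q'} → p ≐ p' → q ≐ q' → (p *ₚ q) ≐ (p' *ₚ q')
  *ₚ-cong {p} {p'} {q} {q'} h k = *ₚ-congˡ p p' q h ⨾ *ₚ-congʳ p' q q' k

  const-*ₚ : ∀ a q → ((a ∷ []) *ₚ q) ≐ scale a q
  const-*ₚ a q = +ₚ-cong ≐-refl zero-poly ⨾ +ₚ-identityʳ (scale a q)

  *ₚ-identityʳ : ∀ p → (p *ₚ (1# ∷ [])) ≐ p
  *ₚ-identityʳ []      = ≐-refl
  *ₚ-identityʳ (a ∷ p) = cons-cong (trans (+-identityʳ _) (*-identityʳ a)) (*ₚ-identityʳ p)

  shiftU-*ₚ : ∀ p q → ((0# ∷ p) *ₚ q) ≐ (0# ∷ (p *ₚ q))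
  shiftU-*ₚ p q = +ₚ-cong (scale-zero q) ≐-refl

  uPlus-*ₚ : ∀ a q → (uPlus a *ₚ q) ≐ (scale a q +ₚ (0# ∷ q))
  uPlus-*ₚ a q = +ₚ-cong ≐-refl (cons-cong refl (const-*ₚ 1# q ⨾ scale-identity q))

  *ₚ-distribˡ : ∀ p q w → (p *ₚ (q +ₚ w)) ≐ ((p *ₚ q) +ₚ (p *ₚ w))
  *ₚ-distribˡ []      q w = ≐-refl
  *ₚ-distribˡ (a ∷ p) q w =
    +ₚ-cong (scale-distribˡ a q w) (cons-cong refl (*ₚ-distribˡ p q w) ⨾ shiftU-+ (p *ₚ q) (p *ₚ w))
    ⨾ +ₚ-interchange (scale a q) (scale a w) (0# ∷ (p *ₚ q)) (0# ∷ (p *ₚ w))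

  *ₚ-distribʳ : ∀ p q w → ((p +ₚ q) *ₚ w) ≐ ((p *ₚ w) +ₚ (q *ₚ w))
  *ₚ-distribʳ []      q       w = ≐-refl
  *ₚ-distribʳ (a ∷ p) []      w = ≐-sym (+ₚ-identityʳ _)
  *ₚ-distribʳ (a ∷ p) (b ∷ q) w =
    +ₚ-cong (scale-distribʳ a b w) (cons-cong refl (*ₚ-distribʳ p q w) ⨾ shiftU-+ (p *ₚ w) (q *ₚ w))
    ⨾ +ₚ-interchange (scale a w) (scale b w) (0# ∷ (p *ₚ w)) (0# ∷ (q *ₚ w))

  scale-*ₚ : ∀ a p q → scale a (p *ₚ q) ≐ (scale a p *ₚ q)
  scale-*ₚ a []      q = ≐-refl
  scale-*ₚ a (b ∷ p) q =
    scale-distribˡ a (scale b q) (0# ∷ (p *ₚ q))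
    ⨾ +ₚ-cong (scale-assoc a b q) (scale-shiftU a (p *ₚ q) ⨾ cons-cong refl (scale-*ₚ a p q))

  *ₚ-scale : ∀ a p q → (p *ₚ scale a q) ≐ scale a (p *ₚ q)
  *ₚ-scale a []      q = ≐-refl
  *ₚ-scale a (b ∷ p) q =
    +ₚ-cong (scale-comm b a q) (cons-cong refl (*ₚ-scale a p q) ⨾ ≐-sym (scale-shiftU a (p *ₚ q)))
    ⨾ ≐-sym (scale-distribˡ a (scale b q) (0# ∷ (p *ₚ q)))

  *ₚ-assoc : ∀ p q w → ((p *ₚ q) *ₚ w) ≐ (p *ₚ (q *ₚ w))
  *ₚ-assoc []      q w = ≐-refl
  *ₚ-assoc (a ∷ p) q w =
    *ₚ-distribʳ (scale a q) (0# ∷ (p *ₚ q)) w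
    ⨾ +ₚ-cong (≐-sym (scale-*ₚ a q w)) (shiftU-*ₚ (p *ₚ q) w ⨾ cons-cong refl (*ₚ-assoc p q w))

  coeff₀-*ₚ : ∀ p q → coeff 0 (p *ₚ q) ≈ coeff 0 p * coeff 0 q
  coeff₀-*ₚ []      q = sym (zeroˡ _)
  coeff₀-*ₚ (a ∷ p) q =
    trans (coeff-+ (scale a q) (0# ∷ (p *ₚ q)) 0) (trans (+-identityʳ _) (coeff-scale a q 0))

  translate-cong : ∀ {a a'} p → a ≈ a' → translate a p ≐ translate a' p
  translate-cong []      e = ≐-refl
  translate-cong (c ∷ p) e =
    +ₚ-cong (≐-refl {c ∷ []}) (*ₚ-cong (cons-cong e (≐-refl {1# ∷ []})) (translate-cong p e))

  translate-zero : ∀ p → translate 0# p ≐ p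
  translate-zero []      = ≐-refl
  translate-zero (b ∷ p) =
    +ₚ-cong (≐-refl {b ∷ []}) (uPlus-*ₚ 0# (translate 0# p)
                               ⨾ +ₚ-cong (scale-zero _) (cons-cong refl (translate-zero p)))
    ⨾ cons-cong (+-identityʳ b) ≐-refl

  translate-const : ∀ b c → translate b (c ∷ []) ≐ (c ∷ [])
  translate-const b c = +ₚ-cong (≐-refl {c ∷ []}) (*ₚ-zeroʳ (uPlus b)) ⨾ +ₚ-identityʳ _

  translate-+ : ∀ b p q → translate b (p +ₚ q) ≐ (translate b p +ₚ translate b q)
  translate-+ b []      q        = ≐-refl
  translate-+ b (a ∷ p) []       = ≐-sym (+ₚ-identityʳ _)
  translate-+ b (a ∷ p) (a' ∷ q) =
    +ₚ-cong (≐-refl {(a + a') ∷ []})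
            (*ₚ-congʳ (uPlus b) _ _ (translate-+ b p q) ⨾ *ₚ-distribˡ (uPlus b) (translate b p) (translate b q))
    ⨾ +ₚ-interchange (a ∷ []) (a' ∷ []) (uPlus b *ₚ translate b p) (uPlus b *ₚ translate b q)

  translate-scale : ∀ b c q → translate b (scale c q) ≐ scale c (translate b q)
  translate-scale b c []      = ≐-refl
  translate-scale b c (d ∷ q) =
    +ₚ-cong (≐-refl {(c * d) ∷ []})
            (*ₚ-congʳ (uPlus b) _ _ (translate-scale b c q) ⨾ *ₚ-scale c (uPlus b) (translate b q))
    ⨾ ≐-sym (scale-distribˡ c (d ∷ []) (uPlus b *ₚ translate b q))

  translate-shiftU : ∀ b w → translate b (0# ∷ w) ≐ (uPlus b *ₚ translate b w)
  translate-shiftU b w = +ₚ-cong zero-poly ≐-refl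

  translate-*ₚ : ∀ b p q → translate b (p *ₚ q) ≐ (translate b p *ₚ translate b q)
  translate-*ₚ b []      q = ≐-refl
  translate-*ₚ b (a ∷ p) q =
    translate-+ b (scale a q) (0# ∷ (p *ₚ q))
    ⨾ +ₚ-cong (translate-scale b a q) (translate-shiftU b (p *ₚ q) ⨾ *ₚ-congʳ (uPlus b) _ _ (translate-*ₚ b p q))
    ⨾ ≐-sym (*ₚ-distribʳ (a ∷ []) (uPlus b *ₚ translate b p) (translate b q)
             ⨾ +ₚ-cong (const-*ₚ a (translate b q)) (*ₚ-assoc (uPlus b) (translate b p) (translate b q)))

  translate-uPlus : ∀ b a → translate b (uPlus a) ≐ uPlus (a + b)
  translate-uPlus b a =
    +ₚ-cong (≐-refl {a ∷ []}) (*ₚ-congʳ (uPlus b) _ _ (translate-const b 1#) ⨾ *ₚ-identityʳ (uPlus b))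

  translate-translate : ∀ a b f → translate b (translate a f) ≐ translate (a + b) f
  translate-translate a b []      = ≐-refl
  translate-translate a b (c ∷ f) =
    translate-+ b (c ∷ []) (uPlus a *ₚ translate a f)
    ⨾ +ₚ-cong (translate-const b c)
              (translate-*ₚ b (uPlus a) (translate a f)
               ⨾ *ₚ-cong (translate-uPlus b a) (translate-translate a b f))

  falling-cong : ∀ {a a'} s → a ≈ a' → falling a s ≐ falling a' s
  falling-cong zero    e = ≐-refl
  falling-cong (suc s) e = *ₚ-cong (falling-cong s e) (cons-cong (+-congʳ e) ≐-refl)

  translate-falling : ∀ b a s → translate b (falling a s) ≐ falling (a + b) s
  translate-falling b a zero    = translate-const b 1#
  translate-falling b a (suc s) =
    translate-*ₚ b (falling a s) (uPlus (a - ι s))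
    ⨾ *ₚ-cong (translate-falling b a s) (translate-uPlus b (a - ι s) ⨾ cons-cong (reorder a (ι s) b) ≐-refl)
    where
    reorder : ∀ a i b → (a - i) + b ≈ (a + b) - i
    reorder = solve 3 (λ a i b → ((a ⊕ ⊝ i) ⊕ b) ⊜ ((a ⊕ b) ⊕ ⊝ i)) refl

  translate-product : ∀ b a c f s →
    translate b (translate a f *ₚ falling c s) ≐ (translate (a + b) f *ₚ falling (c + b) s)
  translate-product b a c f s =
    translate-*ₚ b (translate a f) (falling c s)
    ⨾ *ₚ-cong (translate-translate a b f) (translate-falling b c s)

  -- (j)_s = 0 for j < s: the factor u - j of (u)_s vanishes at u = j.
  falling-vanish : ∀ j s → j < s → coeff 0 (falling (ι j) s) ≈ 0#
  falling-vanish j (suc s) j<1+s with NP.m<1+n⇒m<n∨m≡n j<1+s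
  ... | inj₁ j<s    = trans (coeff₀-*ₚ (falling (ι j) s) (uPlus (ι j - ι s)))
                        (trans (*-congʳ (falling-vanish j s j<s)) (zeroˡ _))
  ... | inj₂ P.refl = trans (coeff₀-*ₚ (falling (ι j) s) (uPlus (ι j - ι j)))
                        (trans (*-congˡ (-‿inverseʳ (ι j))) (zeroʳ _))

  sumTo-cong : ∀ N {g h} → (∀ k → g k ≈ h k) → sumTo N g ≈ sumTo N h
  sumTo-cong zero    e = refl
  sumTo-cong (suc N) e = +-cong (sumTo-cong N e) (e N)

  sumTo-zero : ∀ N {g} → (∀ k → g k ≈ 0#) → sumTo N g ≈ 0#
  sumTo-zero zero    e = refl
  sumTo-zero (suc N) e = trans (+-cong (sumTo-zero N e) (e N)) (+-identityʳ _)

  sumTo-+ : ∀ N g h → sumTo N (λ k → g k + h k) ≈ sumTo N g + sumTo N h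
  sumTo-+ zero    g h = sym (+-identityʳ _)
  sumTo-+ (suc N) g h = trans (+-congʳ (sumTo-+ N g h)) (+-interchange _ _ _ _)

  sumTo-* : ∀ N a g → a * sumTo N g ≈ sumTo N (λ k → a * g k)
  sumTo-* zero    a g = zeroʳ a
  sumTo-* (suc N) a g = trans (distribˡ _ _ _) (+-congʳ (sumTo-* N a g))

  sumTo-extend : ∀ M N {g} → M ≤ N → (∀ k → M ≤ k → g k ≈ 0#) → sumTo N g ≈ sumTo M g
  sumTo-extend zero zero    z≤n  vanish = refl
  sumTo-extend M    (suc N) M≤1+N vanish with NP.m≤n⇒m<n∨m≡n M≤1+N
  ... | inj₁ (s≤s M≤N) = trans (+-cong (sumTo-extend M N M≤N vanish) (vanish N M≤N)) (+-identityʳ _)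
  ... | inj₂ P.refl    = refl

  sumTo-suc : ∀ N g → sumTo (suc N) g ≈ g 0 + sumTo N (λ k → g (suc k))
  sumTo-suc zero    g = trans (+-identityˡ _) (sym (+-identityʳ _))
  sumTo-suc (suc N) g = trans (+-congʳ (sumTo-suc N g)) (+-assoc _ _ _)

  stirling2-vanish : ∀ m k → m < k → stirling2 m k ≡ 0
  stirling2-vanish zero    (suc k) _ = P.refl
  stirling2-vanish (suc m) (suc k) (s≤s m<k)
    rewrite stirling2-vanish m (suc k) (s≤s (NP.<⇒≤ m<k)) | stirling2-vanish m k m<k =
      P.cong (N._+ 0) (NP.*-zeroʳ k)

  -- ffCoord m k p = Σ_i p_i S(m + i, k).  For m = 0 this is the coordinate of p
  -- on the falling factorial (u)_k; the offset m is what recursion over the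
  -- coefficient list requires.
  ffCoord : ℕ → ℕ → Pol → Carrier
  ffCoord m k []      = 0#
  ffCoord m k (a ∷ p) = a * ι (stirling2 m k) + ffCoord (suc m) k p

  -- The Stirling recurrence S(m+1, k+1) = (k+1) S(m, k+1) + S(m, k), lifted.
  ffCoord-suc : ∀ m k p → ffCoord (suc m) (suc k) p ≈ ι (suc k) * ffCoord m (suc k) p + ffCoord m k p
  ffCoord-suc m k []      = sym (trans (+-identityʳ _) (zeroʳ _))
  ffCoord-suc m k (a ∷ p) = begin
    a * ι (suc k N.* S₁ N.+ S₀) + ffCoord (suc (suc m)) (suc k) p
      ≈⟨ +-cong (*-congˡ stirlingStep) (ffCoord-suc (suc m) k p) ⟩
    a * (K * ι S₁ + ι S₀) + (K * ffCoord (suc m) (suc k) p + ffCoord (suc m) k p)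
      ≈⟨ regroup a K (ι S₁) (ι S₀) _ _ ⟩
    K * ffCoord m (suc k) (a ∷ p) + ffCoord m k (a ∷ p) ∎
    where
    K = ι (suc k)
    S₁ = stirling2 m (suc k)
    S₀ = stirling2 m k
    stirlingStep : ι (suc k N.* S₁ N.+ S₀) ≈ K * ι S₁ + ι S₀
    stirlingStep = trans (ι-+ (suc k N.* S₁) S₀) (+-congʳ (ι-* (suc k) S₁))
    regroup : ∀ a K s₁ s₀ d₁ d₀ → a * (K * s₁ + s₀) + (K * d₁ + d₀) ≈ K * (a * s₁ + d₁) + (a * s₀ + d₀)
    regroup = solve 6 (λ a K s₁ s₀ d₁ d₀ →
      (a ⊗ (K ⊗ s₁ ⊕ s₀) ⊕ (K ⊗ d₁ ⊕ d₀)) ⊜ (K ⊗ (a ⊗ s₁ ⊕ d₁) ⊕ (a ⊗ s₀ ⊕ d₀))) refl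

  -- S(m + 1, 0) = 0.
  ffCoord-suc-zero : ∀ m p → ffCoord (suc m) 0 p ≈ 0#
  ffCoord-suc-zero m []      = refl
  ffCoord-suc-zero m (a ∷ p) = trans (+-cong (zeroʳ a) (ffCoord-suc-zero (suc m) p)) (+-identityʳ _)

  ffCoord-zero-zero : ∀ h → ffCoord 0 0 h ≈ coeff 0 h
  ffCoord-zero-zero []      = refl
  ffCoord-zero-zero (a ∷ p) =
    trans (+-cong (trans (*-congˡ (+-identityʳ 1#)) (*-identityʳ a)) (ffCoord-suc-zero 0 p)) (+-identityʳ a)

  ffCoord-+ : ∀ m k p q → ffCoord m k (p +ₚ q) ≈ ffCoord m k p + ffCoord m k q
  ffCoord-+ m k []      q       = sym (+-identityˡ _)
  ffCoord-+ m k (a ∷ p) []      = sym (+-identityʳ _)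
  ffCoord-+ m k (a ∷ p) (b ∷ q) =
    trans (+-cong (distribʳ _ _ _) (ffCoord-+ (suc m) k p q)) (+-interchange _ _ _ _)

  ffCoord-scale : ∀ m k c p → ffCoord m k (scale c p) ≈ c * ffCoord m k p
  ffCoord-scale m k c []      = sym (zeroʳ c)
  ffCoord-scale m k c (a ∷ p) =
    trans (+-cong (*-assoc _ _ _) (ffCoord-scale (suc m) k c p)) (sym (distribˡ _ _ _))

  -- Coordinates of (u + o)·q: the factor u raises every exponent, i.e. the offset m, by one.
  ffCoord-uPlus : ∀ m k o q → ffCoord m k (uPlus o *ₚ q) ≈ o * ffCoord m k q + ffCoord (suc m) k q
  ffCoord-uPlus m k o q = begin
    ffCoord m k (scale o q +ₚ (0# ∷ ((1# ∷ []) *ₚ q)))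
      ≈⟨ ffCoord-+ m k (scale o q) _ ⟩
    ffCoord m k (scale o q) + (0# * _ + ffCoord (suc m) k (scale 1# q +ₚ (0# ∷ [])))
      ≈⟨ +-cong (ffCoord-scale m k o q) (trans (+-congʳ (zeroˡ _)) (+-identityˡ _)) ⟩
    o * ffCoord m k q + ffCoord (suc m) k (scale 1# q +ₚ (0# ∷ []))
      ≈⟨ +-congˡ (ffCoord-+ (suc m) k (scale 1# q) (0# ∷ [])) ⟩
    o * ffCoord m k q + (ffCoord (suc m) k (scale 1# q) + (0# * _ + 0#))
      ≈⟨ +-congˡ (+-cong (trans (ffCoord-scale (suc m) k 1# q) (*-identityˡ _)) (trans (+-identityʳ _) (zeroˡ _))) ⟩
    o * ffCoord m k q + (ffCoord (suc m) k q + 0#)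
      ≈⟨ +-congˡ (+-identityʳ _) ⟩
    o * ffCoord m k q + ffCoord (suc m) k q ∎

  ffCoord-translate : ∀ k h → ffCoord 0 k (translate 1# h) ≈ ffCoord 0 k h + ι (suc k) * ffCoord 0 (suc k) h
  ffCoord-translate k []      = sym (trans (+-identityˡ _) (zeroʳ _))
  ffCoord-translate zero (a ∷ p) = begin
    ffCoord 0 0 ((a ∷ []) +ₚ (uPlus 1# *ₚ q))
      ≈⟨ ffCoord-+ 0 0 (a ∷ []) (uPlus 1# *ₚ q) ⟩
    (a * e + 0#) + ffCoord 0 0 (uPlus 1# *ₚ q)
      ≈⟨ +-cong (+-identityʳ _) (trans (ffCoord-uPlus 0 0 1# q) (trans (+-congˡ (ffCoord-suc-zero 0 q)) (+-identityʳ _))) ⟩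
    a * e + 1# * ffCoord 0 0 q
      ≈⟨ +-congˡ (*-congˡ (ffCoord-translate 0 p)) ⟩
    a * e + 1# * (X + e * Y)
      ≈⟨ regroup a X Y ⟩
    a * e + e * (e * Y + X)
      ≈⟨ +-cong (trans (+-congˡ (ffCoord-suc-zero 0 p)) (+-identityʳ _))
                (*-congˡ (trans (+-cong (zeroʳ a) (ffCoord-suc 0 0 p)) (+-identityˡ _))) ⟨
    ffCoord 0 0 (a ∷ p) + e * ffCoord 0 1 (a ∷ p) ∎
    where
    q = translate 1# p
    e = ι 1
    X = ffCoord 0 0 p
    Y = ffCoord 0 1 p
    -- e = 1# + 0# acts as 1#
    regroup : ∀ a X Y → a * e + 1# * (X + e * Y) ≈ a * e + e * (e * Y + X)
    regroup a X Y = +-congˡ (trans (*-identityˡ _)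
      (trans (+-comm _ _) (sym (trans (*-congʳ (+-identityʳ 1#)) (*-identityˡ _)))))
  ffCoord-translate (suc k) (a ∷ p) = begin
    ffCoord 0 (suc k) ((a ∷ []) +ₚ (uPlus 1# *ₚ q))
      ≈⟨ ffCoord-+ 0 (suc k) (a ∷ []) (uPlus 1# *ₚ q) ⟩
    (a * 0# + 0#) + ffCoord 0 (suc k) (uPlus 1# *ₚ q)
      ≈⟨ +-cong (trans (+-identityʳ _) (zeroʳ a)) (ffCoord-uPlus 0 (suc k) 1# q) ⟩
    0# + (1# * ffCoord 0 (suc k) q + ffCoord 1 (suc k) q)
      ≈⟨ +-identityˡ _ ⟩
    1# * ffCoord 0 (suc k) q + ffCoord 1 (suc k) q
      ≈⟨ +-cong (*-congˡ (ffCoord-translate (suc k) p))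
                (trans (ffCoord-suc 0 k q) (+-cong (*-congˡ (ffCoord-translate (suc k) p)) (ffCoord-translate k p))) ⟩
    1# * (X + (1# + K) * Y) + (K * (X + (1# + K) * Y) + (Z + K * X))
      ≈⟨ regroup 1# K X Y Z ⟩
    (K * X + Z) + (1# + K) * ((1# + K) * Y + X)
      ≈⟨ +-cong (dropHead (ffCoord-suc 0 k p)) (*-congˡ (dropHead (ffCoord-suc 0 (suc k) p))) ⟨
    ffCoord 0 (suc k) (a ∷ p) + ι (suc (suc k)) * ffCoord 0 (suc (suc k)) (a ∷ p) ∎
    where
    q = translate 1# p
    K = ι (suc k)
    X = ffCoord 0 (suc k) p
    Y = ffCoord 0 (suc (suc k)) p
    Z = ffCoord 0 k p
    -- S(0, k + 1) = 0, so the constant coefficient a does not contribute.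
    dropHead : ∀ {y w} → y ≈ w → a * 0# + y ≈ w
    dropHead y≈w = trans (+-congʳ (zeroʳ a)) (trans (+-identityˡ _) y≈w)
    -- 1# is abstracted as the variable one: the identity holds for any one,
    -- and the solver cannot compute with ring constants.
    regroup : ∀ one K X Y Z → one * (X + (one + K) * Y) + (K * (X + (one + K) * Y) + (Z + K * X))
                             ≈ (K * X + Z) + (one + K) * ((one + K) * Y + X)
    regroup = solve 5 (λ one K X Y Z →
      (one ⊗ (X ⊕ (one ⊕ K) ⊗ Y) ⊕ (K ⊗ (X ⊕ (one ⊕ K) ⊗ Y) ⊕ (Z ⊕ K ⊗ X)))
        ⊜ ((K ⊗ X ⊕ Z) ⊕ (one ⊕ K) ⊗ ((one ⊕ K) ⊗ Y ⊕ X))) refl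

  module Evaluation (x : Carrier) where

    umbralFrom-null : ∀ m p → p ≐ [] → umbralFrom m x p ≈ 0#
    umbralFrom-null m []      h = refl
    umbralFrom-null m (a ∷ p) h =
      trans (+-cong (trans (*-congʳ (get h zero)) (zeroˡ _)) (umbralFrom-null (suc m) p (≐-tail₀ h)))
            (+-identityʳ _)

    umbralFrom-cong : ∀ m p q → p ≐ q → umbralFrom m x p ≈ umbralFrom m x q
    umbralFrom-cong m []      []      h = refl
    umbralFrom-cong m []      (a ∷ q) h = sym (umbralFrom-null m (a ∷ q) (≐-sym h))
    umbralFrom-cong m (a ∷ p) []      h = umbralFrom-null m (a ∷ p) h
    umbralFrom-cong m (a ∷ p) (b ∷ q) h =
      +-cong (*-congʳ (get h zero)) (umbralFrom-cong (suc m) p q (≐-tail h))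

    umbral-cong : ∀ {p q} → p ≐ q → umbral x p ≈ umbral x q
    umbral-cong {p} {q} = umbralFrom-cong 0 p q

    term : ℕ → Pol → ℕ → Carrier
    term m p k = (ι (k !) * pow x k) * ffCoord m k p

    -- Σ_i p_i F_{m+i}(x) = Σ_k k! x^k ffCoord m k p (so for m = 0 the umbra sends
    -- (u)_k to k! x^k); any range N past m + deg p will do.
    umbral-expansion : ∀ p m N → m N.+ length p ≤ N → umbralFrom m x p ≈ sumTo N (term m p)
    umbral-expansion []      m N le = sym (sumTo-zero N (λ k → zeroʳ _))
    umbral-expansion (a ∷ p) m N le = begin
      a * fubini m x + umbralFrom (suc m) x p
        ≈⟨ +-cong (*-congˡ fubini-extended) (umbral-expansion p (suc m) N le') ⟩
      a * sumTo N Fm + sumTo N (term (suc m) p)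
        ≈⟨ +-congʳ (sumTo-* N a Fm) ⟩
      sumTo N (λ k → a * Fm k) + sumTo N (term (suc m) p)
        ≈⟨ sumTo-+ N _ _ ⟨
      sumTo N (λ k → a * Fm k + term (suc m) p k)
        ≈⟨ sumTo-cong N (λ k → trans (+-congʳ (*-congˡ (*-congʳ (ι-* (stirling2 m k) (k !))))) (collect a _ _ _ _)) ⟩
      sumTo N (term m (a ∷ p)) ∎
      where
      Fm : ℕ → Carrier
      Fm k = ι (stirling2 m k N.* (k !)) * pow x k
      le' : suc m N.+ length p ≤ N
      le' = P.subst (_≤ N) (NP.+-suc m (length p)) le
      fubini-extended : fubini m x ≈ sumTo N Fm
      fubini-extended = sym (sumTo-extend (suc m) N (NP.≤-trans (s≤s (NP.m≤m+n m (length p))) le')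
        (λ k m<k → trans (*-congʳ (reflexive (P.cong (λ S → ι (S N.* (k !))) (stirling2-vanish m k m<k))))
                         (zeroˡ _)))
      collect : ∀ a s f xk d → a * ((s * f) * xk) + (f * xk) * d ≈ (f * xk) * (a * s + d)
      collect a s f xk d = trans (+-congʳ (rearrange a s f xk)) (sym (distribˡ _ _ _))
        where
        rearrange : ∀ a s f xk → a * ((s * f) * xk) ≈ (f * xk) * (a * s)
        rearrange = solve* 4 (λ a s f xk → (a · ((s · f) · xk)) ⊜* ((f · xk) · (a · s))) refl

    umbral-shift : ∀ h → (x + 1#) * umbral x h ≈ x * umbral x (translate 1# h) + coeff 0 h
    umbral-shift h = begin
      (x + 1#) * umbral x h
        ≈⟨ distribʳ _ _ _ ⟩
      x * umbral x h + 1# * umbral x h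
        ≈⟨ +-cong (*-congˡ (umbral-expansion h 0 N (NP.m≤m+n _ _)))
                  (trans (*-identityˡ _) (umbral-expansion h 0 (suc N) (NP.m≤n⇒m≤1+n (NP.m≤m+n _ _)))) ⟩
      x * sumTo N Th + sumTo (suc N) Th
        ≈⟨ +-cong (sumTo-* N x Th) (sumTo-suc N Th) ⟩
      sumTo N (λ k → x * Th k) + (Th 0 + sumTo N (λ k → Th (suc k)))
        ≈⟨ trans (+-congˡ (+-comm _ _)) (sym (+-assoc _ _ _)) ⟩
      (sumTo N (λ k → x * Th k) + sumTo N (λ k → Th (suc k))) + Th 0
        ≈⟨ +-cong (sym (sumTo-+ N _ _)) constant-term ⟩
      sumTo N (λ k → x * Th k + Th (suc k)) + coeff 0 h
        ≈⟨ +-congʳ (sumTo-cong N (λ k → sym (shifted-term k))) ⟩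
      sumTo N (λ k → x * Tt k) + coeff 0 h
        ≈⟨ +-congʳ (sumTo-* N x Tt) ⟨
      x * sumTo N Tt + coeff 0 h
        ≈⟨ +-congʳ (*-congˡ (umbral-expansion (translate 1# h) 0 N (NP.m≤n+m _ _))) ⟨
      x * umbral x (translate 1# h) + coeff 0 h ∎
      where
      N = length h N.+ length (translate 1# h)
      Th = term 0 h
      Tt = term 0 (translate 1# h)
      constant-term : Th 0 ≈ coeff 0 h
      constant-term = trans (*-congʳ (trans (*-identityʳ _) (+-identityʳ _)))
                            (trans (*-identityˡ _) (ffCoord-zero-zero h))
      -- x k! x^k (c_k + (k+1) c_{k+1}) = x k! x^k c_k + (k+1)! x^{k+1} c_{k+1}
      shifted-term : ∀ k → x * Tt k ≈ x * Th k + Th (suc k)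
      shifted-term k = begin
        x * ((F * xk) * ffCoord 0 k (translate 1# h))
          ≈⟨ *-congˡ (*-congˡ (ffCoord-translate k h)) ⟩
        x * ((F * xk) * (ffCoord 0 k h + K * ffCoord 0 (suc k) h))
          ≈⟨ expand x F xk K _ _ ⟩
        x * Th k + ((K * F) * (x * xk)) * ffCoord 0 (suc k) h
          ≈⟨ +-congˡ (*-congʳ (*-congʳ (ι-* (suc k) (k !)))) ⟨
        x * Th k + Th (suc k) ∎
        where
        F = ι (k !)
        xk = pow x k
        K = ι (suc k)
        expand : ∀ x F xk K c₀ c₁ → x * ((F * xk) * (c₀ + K * c₁)) ≈ x * ((F * xk) * c₀) + ((K * F) * (x * xk)) * c₁
        expand x F xk K c₀ c₁ = trans (*-congˡ (distribˡ _ _ _)) (trans (distribˡ _ _ _) (+-congˡ (rearrange x F xk K c₁)))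
          where
          rearrange : ∀ x F xk K c₁ → x * ((F * xk) * (K * c₁)) ≈ ((K * F) * (x * xk)) * c₁
          rearrange = solve* 5 (λ x F xk K c₁ → (x · ((F · xk) · (K · c₁))) ⊜* (((K · F) · (x · xk)) · c₁)) refl

    umbral-shift-iterate : ∀ n h → (∀ j → j < n → coeff 0 (translate (ι j) h) ≈ 0#) →
      pow (x + 1#) n * umbral x h ≈ pow x n * umbral x (translate (ι n) h)
    umbral-shift-iterate zero    h vanish = *-congˡ (umbral-cong (≐-sym (translate-zero h)))
    umbral-shift-iterate (suc n) h vanish = begin
      ((x + 1#) * pow (x + 1#) n) * umbral x h
        ≈⟨ *-exchange _ _ _ ⟩
      pow (x + 1#) n * ((x + 1#) * umbral x h)
        ≈⟨ *-congˡ (trans (umbral-shift h) (trans (+-congˡ h0≈0) (+-identityʳ _))) ⟩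
      pow (x + 1#) n * (x * umbral x h₁)
        ≈⟨ *-exchange _ _ _ ⟨
      (x * pow (x + 1#) n) * umbral x h₁
        ≈⟨ *-assoc _ _ _ ⟩
      x * (pow (x + 1#) n * umbral x h₁)
        ≈⟨ *-congˡ (umbral-shift-iterate n h₁ (λ j j<n → trans (get (shift-once j) 0) (vanish (suc j) (s≤s j<n)))) ⟩
      x * (pow x n * umbral x (translate (ι n) h₁))
        ≈⟨ *-assoc _ _ _ ⟨
      (x * pow x n) * umbral x (translate (ι n) h₁)
        ≈⟨ *-congˡ (umbral-cong (shift-once n)) ⟩
      (x * pow x n) * umbral x (translate (ι (suc n)) h) ∎
      where
      h₁ = translate 1# h
      h0≈0 : coeff 0 h ≈ 0#
      h0≈0 = trans (sym (get (translate-zero h) 0)) (vanish 0 (s≤s z≤n))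
      shift-once : ∀ j → translate (ι j) h₁ ≐ translate (ι (suc j)) h
      shift-once j = translate-translate 1# (ι j) h

-- The corollary: take h(u) = f(u + r - s)(u)_s, which vanishes at u = 0, …, s-1
-- because (u)_s does, and whose shift h(u + s) is f(u + r)(u + s)_s.
corollary2 : ∀ {c ℓ : Level} (R : CommutativeRing c ℓ) →
    let open CommutativeRing R
        open Poly R
    in (f : List Carrier) (r s : ℕ) (x : Carrier) →
       pow (x + 1#) s * umbral x (translate (ι r - ι s) f *ₚ falling 0# s)
         ≈ pow x s * umbral x (translate (ι r) f *ₚ falling (ι s) s)
corollary2 R f r s x =
  trans (umbral-shift-iterate s h vanish) (*-congˡ (umbral-cong shifted))
  where
  open CommutativeRing R
  open Poly R
  open UmbralShift R
  open Evaluation x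
  a = ι r - ι s
  h = translate a f *ₚ falling 0# s
  a+s≈r : a + ι s ≈ ι r
  a+s≈r = trans (+-assoc _ _ _) (trans (+-congˡ (-‿inverseˡ _)) (+-identityʳ _))
  -- h(j) = f(j + r - s) · (j)_s = 0 for j < s
  vanish : ∀ j → j < s → coeff 0 (translate (ι j) h) ≈ 0#
  vanish j j<s = trans (_≐_.get (translate-product (ι j) a 0# f s) 0)
    (trans (coeff₀-*ₚ (translate (a + ι j) f) (falling (0# + ι j) s))
    (trans (*-congˡ (trans (_≐_.get (falling-cong s (+-identityˡ (ι j))) 0) (falling-vanish j s j<s))) (zeroʳ _)))
  shifted : translate (ι s) h ≐ (translate (ι r) f *ₚ falling (ι s) s)
  shifted = translate-product (ι s) a 0# f s
          ⨾ *ₚ-cong (translate-cong f a+s≈r) (falling-cong s (+-identityˡ (ι s)))
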